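{- Let $\mathbf{PCL}=\mathbf{CL}(\{p\wedge(q\vee r)\trianglelefteq(p\wedge q)\vee(p\wedge r)\})$. Then $\mathbf{PCL}$ is sound and complete with respect to the class of distributive selection L-frames: a consequence pair belongs to $\mathbf{PCL}$ iff it is validated by every selection L-frame whose underlying semilattice is distributive.
   Context: Formulas: $\phi::=p\mid\top\mid\bot\mid\phi\wedge\phi\mid\phi\vee\phi\mid\phi\Rightarrow\phi$. $\mathbf{CL}(\Gamma)$ is the smallest set of consequence pairs $\phi\trianglelefteq\psi$ containing $\Gamma$, closed under uniform substitution, containing $p\trianglelefteq\top$, $\bot\trianglelefteq p$, $p\trianglelefteq p$, $p\wedge q\trianglelefteq p$, $p\wedge q\trianglelefteq q$, $p\trianglelefteq p\vee q$, $q\trianglelefteq p\vee q$, $\top\trianglelefteq p\Rightarrow\top$, $p\Rightarrow(q\wedge r)\trianglelefteq(p\Rightarrow q)\wedge(p\Rightarrow r)$, $(p\Rightarrow q)\wedge(p\Rightarrow r)\trianglelefteq p\Rightarrow(q\wedge r)$, closed under transitivity, $\wedge$-introduction (from $r\trianglelefteq p,r\trianglelefteq q$ infer $r\trianglelefteq p\wedge q$), $\vee$-elimination (from $p\trianglelefteq r,q\trianglelefteq r$ infer $p\vee q\trianglelefteq r$), and congruence for $\Rightarrow$ in each argument. A meet-semilattice $(X,1,\curlywedge)$ (order $x\preccurlyeq y$ iff $x\curlywedge y=x$) is distributive if whenever $x\curlywedge y\preccurlyeq z$ there exist $u,v$ with $x\preccurlyeq u$, $y\preccurlyeq v$ and $z=u\curlywedge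 v$. A selection L-frame is $(X,1,\curlywedge,s)$ with $s:X\times\mathcal F(X)\to\mathcal F(X)$ ($\mathcal F(X)$ the filters: upward closed, closed under finite meets) such that $s(1,a)=\{1\}$; $x\preccurlyeq y$ implies $s(y,a)\subseteq s(x,a)$; if $z\in s(x\curlywedge y,a)$ there are $u\in s(x,a)$, $v\in s(y,a)$ with $u\curlywedge v\preccurlyeq z$. Under a valuation $V$ (letters to filters): $x\Vdash p$ iff $x\in V(p)$; $\top$ always; $x\Vdash\bot$ iff $x=1$; $\wedge$ pointwise; $x\Vdash\phi\vee\psi$ iff some $y\Vdash\phi$, $z\Vdash\psi$ have $y\curlywedge z\preccurlyeq x$; $x\Vdash\phi\Rightarrow\psi$ iff $s(x,[\![\phi]\!])\subseteq[\![\psi]\!]$. A frame validates $\phi\trianglelefteq\psi$ if $[\![\phi]\!]\subseteq[\![\psi]\!]$ for all valuations. -}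

module Defs where

open import Level using (0ℓ)
open import Data.Nat using (ℕ)
open import Data.Product using (Σ; Σ-syntax; _×_; _,_; proj₁; proj₂)
open import Data.Unit using (tt) renaming (⊤ to Unit)
open import Function.Bundles using (_⇔_)
open import Algebra.Bundles using (CommutativeSemigroup)
open import Algebra.Lattice.Bundles using (BoundedMeetSemilattice; BoundedSemilattice)
import Algebra.Properties.CommutativeSemigroup as CSProps

infixr 6 _∧f_
infixr 5 _∨f_
infixr 4 _⇒f_

data Formula : Set where
  var   : ℕ → Formula
  ⊤f    : Formula
  ⊥f    : Formula
  _∧f_  : Formula → Formula → Formula
  _∨f_  : Formula → Formula → Formula
  _⇒f_  : Formula → Formula → Formula

sub : (ℕ → Formula) → Formula → Formula
sub σ (var n)  = σ n
sub σ ⊤f       = ⊤f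
sub σ ⊥f       = ⊥f
sub σ (φ ∧f ψ) = sub σ φ ∧f sub σ ψ
sub σ (φ ∨f ψ) = sub σ φ ∨f sub σ ψ
sub σ (φ ⇒f ψ) = sub σ φ ⇒f sub σ ψ

p q r : Formula
p = var 0
q = var 1
r = var 2

-- A set of consequence pairs is a binary predicate on formulas.
-- CL Γ φ ψ  means  (φ ⊴ ψ) ∈ CL(Γ).
data CL (Γ : Formula → Formula → Set) : Formula → Formula → Set where
  hyp     : ∀ {φ ψ} → Γ φ ψ → CL Γ φ ψ
  cl-subst : ∀ {φ ψ} (σ : ℕ → Formula) → CL Γ φ ψ → CL Γ (sub σ φ) (sub σ ψ)
  ax-top  : CL Γ p ⊤f
  ax-bot  : CL Γ ⊥f p
  ax-refl : CL Γ p p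
  ax-∧₁   : CL Γ (p ∧f q) p
  ax-∧₂   : CL Γ (p ∧f q) q
  ax-∨₁   : CL Γ p (p ∨f q)
  ax-∨₂   : CL Γ q (p ∨f q)
  ax-⇒⊤   : CL Γ ⊤f (p ⇒f ⊤f)
  ax-⇒∧₁  : CL Γ (p ⇒f (q ∧f r)) ((p ⇒f q) ∧f (p ⇒f r))
  ax-⇒∧₂  : CL Γ ((p ⇒f q) ∧f (p ⇒f r)) (p ⇒f (q ∧f r))
  cl-trans : ∀ {φ ψ χ} → CL Γ φ ψ → CL Γ ψ χ → CL Γ φ χ
  ∧-intro : ∀ {φ ψ χ} → CL Γ χ φ → CL Γ χ ψ → CL Γ χ (φ ∧f ψ)
  ∨-elim  : ∀ {φ ψ χ} → CL Γ φ χ → CL Γ ψ χ → CL Γ (φ ∨f ψ) χ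
  ⇒-congˡ : ∀ {φ φ' ψ} → CL Γ φ φ' → CL Γ φ' φ → CL Γ (φ ⇒f ψ) (φ' ⇒f ψ)
  ⇒-congʳ : ∀ {φ ψ ψ'} → CL Γ ψ ψ' → CL Γ ψ' ψ → CL Γ (φ ⇒f ψ) (φ ⇒f ψ')

data PCLΓ : Formula → Formula → Set where
  distr : PCLΓ (p ∧f (q ∨f r)) ((p ∧f q) ∨f (p ∧f r))

PCL : Formula → Formula → Set
PCL = CL PCLΓ

module SL (L : BoundedMeetSemilattice 0ℓ 0ℓ) where
  open BoundedMeetSemilattice L public

  infix 4 _≼_
  _≼_ : Carrier → Carrier → Set
  x ≼ y = (x ∧ y) ≈ x

  Distributive : Set
  Distributive = ∀ x y z → (x ∧ y) ≼ z →
    Σ[ u ∈ Carrier ] Σ[ v ∈ Carrier ] (x ≼ u × y ≼ v × z ≈ (u ∧ v))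

  record Filter : Set₁ where
    field
      _∋_  : Carrier → Set
      up   : ∀ {x y} → _∋_ x → x ≼ y → _∋_ y
      top  : _∋_ ⊤
      meet : ∀ {x y} → _∋_ x → _∋_ y → _∋_ (x ∧ y)
  open Filter public

  ∧-commSemigroup : CommutativeSemigroup 0ℓ 0ℓ
  ∧-commSemigroup = record
    { isCommutativeSemigroup =
        BoundedSemilattice.isCommutativeSemigroup boundedSemilattice }

  ∧-interchange : ∀ a b c d → ((a ∧ b) ∧ (c ∧ d)) ≈ ((a ∧ c) ∧ (b ∧ d))
  ∧-interchange = CSProps.interchange ∧-commSemigroup

  ≼-respˡ : ∀ {x x' y} → x ≈ x' → x ≼ y → x' ≼ y
  ≼-respˡ {x} {x'} {y} e h = trans (∧-congʳ (sym e)) (trans h e)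

  ≼-trans : ∀ {x y z} → x ≼ y → y ≼ z → x ≼ z
  ≼-trans {x} {y} {z} h k =
    trans (∧-congʳ (sym h))
     (trans (assoc x y z) (trans (∧-congˡ k) h))

  ≼-top : ∀ x → x ≼ ⊤
  ≼-top x = identityʳ x

  ≈⇒≼ : ∀ {x y} → x ≈ y → x ≼ y
  ≈⇒≼ {x} {y} e = trans (∧-congˡ (sym e)) (idem x)

  ∧-mono : ∀ {a b c d} → a ≼ b → c ≼ d → (a ∧ c) ≼ (b ∧ d)
  ∧-mono {a} {b} {c} {d} h k =
    trans (∧-interchange a c b d) (∧-cong h k)

record SelectionLFrame : Set₁ where
  field
    L : BoundedMeetSemilattice 0ℓ 0ℓ
  open SL L
  field
    s      : Carrier → Filter → Filter
    s-top  : ∀ a z → (s ⊤ a ∋ z) ⇔ (z ≈ ⊤)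
    s-anti : ∀ {x y} a → x ≼ y → ∀ z → s y a ∋ z → s x a ∋ z
    s-meet : ∀ x y a z → s (x ∧ y) a ∋ z →
             Σ[ u ∈ Carrier ] Σ[ v ∈ Carrier ]
               (s x a ∋ u × s y a ∋ v × (u ∧ v) ≼ z)
    -- s is a function of the filter *as a set* (extensionality)
    s-ext  : ∀ x a b → (∀ w → (a ∋ w) ⇔ (b ∋ w)) →
             ∀ z → s x a ∋ z → s x b ∋ z

module Semantics (F : SelectionLFrame) where
  open SelectionLFrame F
  open SL L

  Valuation : Set₁
  Valuation = ℕ → Filter

  private
    ⊤F : Filter
    ⊤F = record { _∋_ = λ _ → Unit ; up = λ _ _ → tt ; top = tt
                ; meet = λ _ _ → tt }

    ⊥F : Filter
    ⊥F = record
      { _∋_ = λ x → x ≈ ⊤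
      ; up = λ {x} {y} e h →
          trans (sym (identityˡ y)) (trans (∧-congʳ (sym e)) (trans h e))
      ; top = refl
      ; meet = λ e f → trans (∧-cong e f) (identityʳ ⊤)
      }

    ∧F : Filter → Filter → Filter
    ∧F a b = record
      { _∋_ = λ x → (a ∋ x) × (b ∋ x)
      ; up = λ (h , k) l → up a h l , up b k l
      ; top = top a , top b
      ; meet = λ (h , k) (h' , k') → meet a h h' , meet b k k'
      }

    ∨F : Filter → Filter → Filter
    ∨F a b = record
      { _∋_ = λ x → Σ[ y ∈ Carrier ] Σ[ z ∈ Carrier ]
                      (a ∋ y × b ∋ z × (y ∧ z) ≼ x)
      ; up = λ (y , z , h , k , l) m → y , z , h , k , ≼-trans l m
      ; top = ⊤ , ⊤ , top a , top b , ≼-top (⊤ ∧ ⊤)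
      ; meet = λ (y , z , h , k , l) (y' , z' , h' , k' , l') →
          y ∧ y' , z ∧ z' , meet a h h' , meet b k k' ,
          ≼-respˡ (∧-interchange y z y' z') (∧-mono l l')
      }

    ⇒F : Filter → Filter → Filter
    ⇒F a b = record
      { _∋_ = λ x → ∀ z → s x a ∋ z → b ∋ z
      ; up = λ h l z m → h z (s-anti a l z m)
      ; top = λ z m → up b (top b)
                (≈⇒≼ (sym (Function.Bundles.Equivalence.to (s-top a z) m)))
      ; meet = λ {x} {y} h k z m →
          let (u , v , hu , hv , l) = s-meet x y a z m
          in up b (meet b (h u hu) (k v hv)) l
      }

  ⟦_⟧ : Formula → Valuation → Filter
  ⟦ var n ⟧  V = V n
  ⟦ ⊤f ⟧     V = ⊤F
  ⟦ ⊥f ⟧     V = ⊥F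
  ⟦ φ ∧f ψ ⟧ V = ∧F (⟦ φ ⟧ V) (⟦ ψ ⟧ V)
  ⟦ φ ∨f ψ ⟧ V = ∨F (⟦ φ ⟧ V) (⟦ ψ ⟧ V)
  ⟦ φ ⇒f ψ ⟧ V = ⇒F (⟦ φ ⟧ V) (⟦ ψ ⟧ V)

  _,_⊩_ : Valuation → Carrier → Formula → Set
  V , x ⊩ φ = ⟦ φ ⟧ V ∋ x

Validates : SelectionLFrame → Formula → Formula → Set₁
Validates F φ ψ = ∀ V x → V , x ⊩ φ → V , x ⊩ ψ
  where open Semantics F

DistributiveFrame : SelectionLFrame → Set
DistributiveFrame F = SL.Distributive (SelectionLFrame.L F)

-- Soundness is a routine induction on derivations; distributivity of the
-- semilattice is exactly what validates the distribution axiom.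
-- Completeness goes through a canonical frame whose points are the filters of
-- the Lindenbaum algebra of PCL, ordered by inclusion, with φ true at a filter
-- iff φ belongs to it.  PCL-distributivity makes this semilattice distributive
-- (if c ∩ d ⊆ e then e = (c ⊔ e) ∩ (d ⊔ e)), and the selection s(x, ⟦φ⟧) is
-- the up-set of {χ | φ ⇒ χ ∈ x}, so that the truth lemma holds for ⇒.

module Submission where

open import Defs
open import Level using (0ℓ)
open import Data.Nat using (ℕ; zero; suc)
open import Data.Product using (Σ-syntax; _×_; _,_; proj₁; proj₂)
open import Data.Sum using (_⊎_; inj₁; inj₂)
open import Data.Unit using (tt)
open import Function.Bundles using (_⇔_; mk⇔; Equivalence)
open import Function.Construct.Symmetry using (⇔-sym)
open import Algebra.Lattice.Bundles using (BoundedMeetSemilattice)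
import Relation.Binary.Construct.NaturalOrder.Left as LeftOrder

open Equivalence using (to; from)

module Soundness (F : SelectionLFrame) where
  open SelectionLFrame F
  open SL L
  open Semantics F

  x∧y≼x : ∀ x y → x ∧ y ≼ x
  x∧y≼x x y = sym (LeftOrder.x∙y≤x _≈_ _∧_ isMeetSemilattice x y)

  x∧y≼y : ∀ x y → x ∧ y ≼ y
  x∧y≼y x y = sym (LeftOrder.x∙y≤y _≈_ _∧_ isMeetSemilattice x y)

  ⟦sub⟧ : ∀ σ φ V x → (⟦ sub σ φ ⟧ V ∋ x) ⇔ (⟦ φ ⟧ (λ n → ⟦ σ n ⟧ V) ∋ x)
  ⟦sub⟧ σ (var n)  V x = mk⇔ (λ h → h) (λ h → h)
  ⟦sub⟧ σ ⊤f       V x = mk⇔ (λ h → h) (λ h → h)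
  ⟦sub⟧ σ ⊥f       V x = mk⇔ (λ h → h) (λ h → h)
  ⟦sub⟧ σ (φ ∧f ψ) V x = mk⇔
    (λ (h , k) → to (⟦sub⟧ σ φ V x) h , to (⟦sub⟧ σ ψ V x) k)
    (λ (h , k) → from (⟦sub⟧ σ φ V x) h , from (⟦sub⟧ σ ψ V x) k)
  ⟦sub⟧ σ (φ ∨f ψ) V x = mk⇔
    (λ (y , z , h , k , l) → y , z , to (⟦sub⟧ σ φ V y) h , to (⟦sub⟧ σ ψ V z) k , l)
    (λ (y , z , h , k , l) → y , z , from (⟦sub⟧ σ φ V y) h , from (⟦sub⟧ σ ψ V z) k , l)
  ⟦sub⟧ σ (φ ⇒f ψ) V x = mk⇔
    (λ h z m → to (⟦sub⟧ σ ψ V z) (h z (s-ext x _ _ (λ w → ⇔-sym (⟦sub⟧ σ φ V w)) z m)))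
    (λ h z m → from (⟦sub⟧ σ ψ V z) (h z (s-ext x _ _ (⟦sub⟧ σ φ V) z m)))

  CL-sound : ∀ {Γ} → (∀ {φ ψ} → Γ φ ψ → Validates F φ ψ) →
             ∀ {φ ψ} → CL Γ φ ψ → Validates F φ ψ
  CL-sound Γ-valid (hyp g) = Γ-valid g
  CL-sound Γ-valid (cl-subst {φ} {ψ} σ d) V x h =
    from (⟦sub⟧ σ ψ V x) (CL-sound Γ-valid d _ x (to (⟦sub⟧ σ φ V x) h))
  CL-sound Γ-valid ax-top V x h = tt
  CL-sound Γ-valid ax-bot V x h = up (V 0) (top (V 0)) (≈⇒≼ (sym h))
  CL-sound Γ-valid ax-refl V x h = h
  CL-sound Γ-valid ax-∧₁ V x h = proj₁ h
  CL-sound Γ-valid ax-∧₂ V x h = proj₂ h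
  CL-sound Γ-valid ax-∨₁ V x h = x , ⊤ , h , top (V 1) , ≈⇒≼ (identityʳ x)
  CL-sound Γ-valid ax-∨₂ V x h = ⊤ , x , top (V 0) , h , ≈⇒≼ (identityˡ x)
  CL-sound Γ-valid ax-⇒⊤ V x h = λ _ _ → tt
  CL-sound Γ-valid ax-⇒∧₁ V x h = (λ z m → proj₁ (h z m)) , (λ z m → proj₂ (h z m))
  CL-sound Γ-valid ax-⇒∧₂ V x (h , k) = λ z m → h z m , k z m
  CL-sound Γ-valid (cl-trans d e) V x h =
    CL-sound Γ-valid e V x (CL-sound Γ-valid d V x h)
  CL-sound Γ-valid (∧-intro d e) V x h =
    CL-sound Γ-valid d V x h , CL-sound Γ-valid e V x h
  CL-sound Γ-valid (∨-elim {χ = χ} d e) V x (y , z , h , k , l) =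
    up (⟦ χ ⟧ V) (meet (⟦ χ ⟧ V) (CL-sound Γ-valid d V y h) (CL-sound Γ-valid e V z k)) l
  CL-sound Γ-valid (⇒-congˡ d e) V x h z m =
    h z (s-ext x _ _ (λ w → mk⇔ (CL-sound Γ-valid e V w) (CL-sound Γ-valid d V w)) z m)
  CL-sound Γ-valid (⇒-congʳ d e) V x h z m = CL-sound Γ-valid d V z (h z m)

  distributive⇒distr-valid : Distributive →
    Validates F (p ∧f (q ∨f r)) ((p ∧f q) ∨f (p ∧f r))
  distributive⇒distr-valid dist V x (x⊩p , y , z , y⊩q , z⊩r , y∧z≼x)
    with dist y z x y∧z≼x
  ... | u , v , y≼u , z≼v , x≈u∧v =
    u , v , (up (V 0) x⊩p x≼u , up (V 1) y⊩q y≼u) ,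
            (up (V 0) x⊩p x≼v , up (V 2) z⊩r z≼v) , ≈⇒≼ (sym x≈u∧v)
    where
    x≼u : x ≼ u
    x≼u = ≼-respˡ (sym x≈u∧v) (x∧y≼x u v)
    x≼v : x ≼ v
    x≼v = ≼-respˡ (sym x≈u∧v) (x∧y≼y u v)

PCL-sound : ∀ {φ ψ} → PCL φ ψ → ∀ F → DistributiveFrame F → Validates F φ ψ
PCL-sound d F dist = CL-sound (λ { distr → distributive⇒distr-valid dist }) d
  where open Soundness F

module Derived (Γ : Formula → Formula → Set) where
  infixr 3 _⨾_
  _⨾_ : ∀ {A B C} → CL Γ A B → CL Γ B C → CL Γ A C
  _⨾_ = cl-trans

  subst₃ : Formula → Formula → Formula → ℕ → Formula
  subst₃ A B C zero          = A
  subst₃ A B C (suc zero)    = B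
  subst₃ A B C (suc (suc _)) = C

  ⊴-refl : ∀ A → CL Γ A A
  ⊴-refl A = cl-subst (subst₃ A A A) ax-refl

  ⊴-⊤ : ∀ A → CL Γ A ⊤f
  ⊴-⊤ A = cl-subst (subst₃ A A A) ax-top

  ⊥-⊴ : ∀ A → CL Γ ⊥f A
  ⊥-⊴ A = cl-subst (subst₃ A A A) ax-bot

  ∧-elimˡ : ∀ {A B} → CL Γ (A ∧f B) A
  ∧-elimˡ {A} {B} = cl-subst (subst₃ A B B) ax-∧₁

  ∧-elimʳ : ∀ {A B} → CL Γ (A ∧f B) B
  ∧-elimʳ {A} {B} = cl-subst (subst₃ A B B) ax-∧₂

  ∨-introˡ : ∀ {A B} → CL Γ A (A ∨f B)
  ∨-introˡ {A} {B} = cl-subst (subst₃ A B B) ax-∨₁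

  ∨-introʳ : ∀ {A B} → CL Γ B (A ∨f B)
  ∨-introʳ {A} {B} = cl-subst (subst₃ A B B) ax-∨₂

  ⊤-⊴-⇒⊤ : ∀ A → CL Γ ⊤f (A ⇒f ⊤f)
  ⊤-⊴-⇒⊤ A = cl-subst (subst₃ A A A) ax-⇒⊤

  ⇒-∧-split : ∀ {A B C} → CL Γ (A ⇒f (B ∧f C)) ((A ⇒f B) ∧f (A ⇒f C))
  ⇒-∧-split {A} {B} {C} = cl-subst (subst₃ A B C) ax-⇒∧₁

  ⇒-∧-merge : ∀ {A B C} → CL Γ ((A ⇒f B) ∧f (A ⇒f C)) (A ⇒f (B ∧f C))
  ⇒-∧-merge {A} {B} {C} = cl-subst (subst₃ A B C) ax-⇒∧₂

  ∧-mono : ∀ {A A' B B'} → CL Γ A A' → CL Γ B B' → CL Γ (A ∧f B) (A' ∧f B')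
  ∧-mono h k = ∧-intro (∧-elimˡ ⨾ h) (∧-elimʳ ⨾ k)

  ∨-mono : ∀ {A A' B B'} → CL Γ A A' → CL Γ B B' → CL Γ (A ∨f B) (A' ∨f B')
  ∨-mono h k = ∨-elim (h ⨾ ∨-introˡ) (k ⨾ ∨-introʳ)

  ∧-interchange : ∀ {A B C D} → CL Γ ((A ∧f B) ∧f (C ∧f D)) ((A ∧f C) ∧f (B ∧f D))
  ∧-interchange = ∧-intro (∧-mono ∧-elimˡ ∧-elimˡ) (∧-mono ∧-elimʳ ∧-elimʳ)

  -- ⇒ is only congruent for interderivable arguments; monotonicity comes from
  -- B ⟛ B ∧ B' followed by the distribution of ⇒ over ∧.
  ⇒-monoʳ : ∀ {A B B'} → CL Γ B B' → CL Γ (A ⇒f B) (A ⇒f B')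
  ⇒-monoʳ {B = B} h = ⇒-congʳ (∧-intro (⊴-refl B) h) ∧-elimˡ ⨾ ⇒-∧-split ⨾ ∧-elimʳ

open Derived PCLΓ

distrib : ∀ {A B C} → PCL (A ∧f (B ∨f C)) ((A ∧f B) ∨f (A ∧f C))
distrib {A} {B} {C} = cl-subst (subst₃ A B C) (hyp distr)

∨-∧-split : ∀ {A B C D} → PCL ((A ∨f B) ∧f (C ∧f D)) ((A ∧f C) ∨f (B ∧f D))
∨-∧-split = ∧-intro ∧-elimʳ ∧-elimˡ ⨾ distrib ⨾
  ∨-mono (∧-intro ∧-elimʳ (∧-elimˡ ⨾ ∧-elimˡ)) (∧-intro ∧-elimʳ (∧-elimˡ ⨾ ∧-elimʳ))

-- Filters of the Lindenbaum algebra, given by a small syntax so that the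
-- canonical semilattice has its carrier in Set: ↑ φ is principal, ⊔ is the
-- generated join, and ⇒-preimage φ c is {χ | φ ⇒ χ ∈ c}.
infixr 6 _∩_
infixr 5 _⊔_

data Code : Set where
  ↑_          : Formula → Code
  _∩_ _⊔_     : Code → Code → Code
  ⇒-preimage  : Formula → Code → Code

infix 4 _∈ᶜ_ _⊆ᶜ_ _≈ᶜ_

_∈ᶜ_ : Formula → Code → Set
χ ∈ᶜ ↑ φ              = PCL φ χ
χ ∈ᶜ c ∩ d            = χ ∈ᶜ c × χ ∈ᶜ d
χ ∈ᶜ c ⊔ d            = Σ[ a ∈ Formula ] Σ[ b ∈ Formula ] (a ∈ᶜ c × b ∈ᶜ d × PCL (a ∧f b) χ)
χ ∈ᶜ ⇒-preimage φ c   = (φ ⇒f χ) ∈ᶜ c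

∈ᶜ-upward : ∀ c {a b} → a ∈ᶜ c → PCL a b → b ∈ᶜ c
∈ᶜ-upward (↑ φ)            h a⊴b = h ⨾ a⊴b
∈ᶜ-upward (c ∩ d)          (h , k) a⊴b = ∈ᶜ-upward c h a⊴b , ∈ᶜ-upward d k a⊴b
∈ᶜ-upward (c ⊔ d)          (a , b , h , k , e) a⊴b = a , b , h , k , (e ⨾ a⊴b)
∈ᶜ-upward (⇒-preimage φ c) h a⊴b = ∈ᶜ-upward c h (⇒-monoʳ a⊴b)

⊤f∈ᶜ : ∀ c → ⊤f ∈ᶜ c
⊤f∈ᶜ (↑ φ)            = ⊴-⊤ φ
⊤f∈ᶜ (c ∩ d)          = ⊤f∈ᶜ c , ⊤f∈ᶜ d
⊤f∈ᶜ (c ⊔ d)          = ⊤f , ⊤f , ⊤f∈ᶜ c , ⊤f∈ᶜ d , ∧-elimˡ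
⊤f∈ᶜ (⇒-preimage φ c) = ∈ᶜ-upward c (⊤f∈ᶜ c) (⊤-⊴-⇒⊤ φ)

∈ᶜ-∧ : ∀ c {a b} → a ∈ᶜ c → b ∈ᶜ c → (a ∧f b) ∈ᶜ c
∈ᶜ-∧ (↑ φ)            h k = ∧-intro h k
∈ᶜ-∧ (c ∩ d)          (h , k) (h' , k') = ∈ᶜ-∧ c h h' , ∈ᶜ-∧ d k k'
∈ᶜ-∧ (c ⊔ d)          (a , b , h , k , e) (a' , b' , h' , k' , e') =
  a ∧f a' , b ∧f b' , ∈ᶜ-∧ c h h' , ∈ᶜ-∧ d k k' , (∧-interchange ⨾ ∧-mono e e')
∈ᶜ-∧ (⇒-preimage φ c) h k = ∈ᶜ-upward c (∈ᶜ-∧ c h k) ⇒-∧-merge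

_⊆ᶜ_ : Code → Code → Set
c ⊆ᶜ d = ∀ χ → χ ∈ᶜ c → χ ∈ᶜ d

⊆-⊔ˡ : ∀ c d → c ⊆ᶜ c ⊔ d
⊆-⊔ˡ c d χ h = χ , ⊤f , h , ⊤f∈ᶜ d , ∧-elimˡ

⊆-⊔ʳ : ∀ c d → d ⊆ᶜ c ⊔ d
⊆-⊔ʳ c d χ h = ⊤f , χ , ⊤f∈ᶜ c , h , ∧-elimʳ

-- From a ∈ c and b ∈ d we get a ∨ b ∈ c ∩ d ⊆ e, and PCL-distributivity
-- turns a ∧ c' ⊴ χ and b ∧ d' ⊴ χ into (a ∨ b) ∧ (c' ∧ d') ⊴ χ.
⊔-∩-⊆ : ∀ c d e → c ∩ d ⊆ᶜ e → (c ⊔ e) ∩ (d ⊔ e) ⊆ᶜ e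
⊔-∩-⊆ c d e c∩d⊆e χ ((a , c' , a∈c , c'∈e , a∧c'⊴χ) , (b , d' , b∈d , d'∈e , b∧d'⊴χ)) =
  ∈ᶜ-upward e (∈ᶜ-∧ e a∨b∈e (∈ᶜ-∧ e c'∈e d'∈e)) (∨-∧-split ⨾ ∨-elim a∧c'⊴χ b∧d'⊴χ)
  where
  a∨b∈e : (a ∨f b) ∈ᶜ e
  a∨b∈e = c∩d⊆e (a ∨f b) (∈ᶜ-upward c a∈c ∨-introˡ , ∈ᶜ-upward d b∈d ∨-introʳ)

_≈ᶜ_ : Code → Code → Set
c ≈ᶜ d = c ⊆ᶜ d × d ⊆ᶜ c

codeSemilattice : BoundedMeetSemilattice 0ℓ 0ℓ
codeSemilattice = record
  { Carrier = Code
  ; _≈_ = _≈ᶜ_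
  ; _∧_ = _∩_
  ; ⊤ = ↑ ⊥f
  ; isBoundedMeetSemilattice = record
    { isCommutativeMonoid = record
      { isMonoid = record
        { isSemigroup = record
          { isMagma = record
            { isEquivalence = record
              { refl = (λ _ h → h) , (λ _ h → h)
              ; sym = λ (f , g) → g , f
              ; trans = λ (f , g) (f' , g') → (λ χ h → f' χ (f χ h)) , (λ χ h → g χ (g' χ h))
              }
            ; ∙-cong = λ (f , g) (f' , g') →
                (λ χ (h , k) → f χ h , f' χ k) , (λ χ (h , k) → g χ h , g' χ k)
            }
          ; assoc = λ _ _ _ → (λ χ ((a , b) , c) → a , (b , c)) , (λ χ (a , (b , c)) → (a , b) , c)
          }
        ; identity = (λ _ → (λ χ → proj₂) , (λ χ h → ⊥-⊴ χ , h))
                   , (λ _ → (λ χ → proj₁) , (λ χ h → h , ⊥-⊴ χ))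
        }
      ; comm = λ _ _ → (λ χ (a , b) → b , a) , (λ χ (a , b) → b , a)
      }
    ; idem = λ _ → (λ χ → proj₁) , (λ χ h → h , h)
    }
  }

open SL codeSemilattice using (Filter; _∋_; up; top; meet; Distributive) renaming (_≼_ to _≼ᶜ_)

≼ᶜ⇒⊆ᶜ : ∀ c d → c ≼ᶜ d → c ⊆ᶜ d
≼ᶜ⇒⊆ᶜ c d (_ , c⊆c∩d) χ h = proj₂ (c⊆c∩d χ h)

⊆ᶜ⇒≼ᶜ : ∀ c d → c ⊆ᶜ d → c ≼ᶜ d
⊆ᶜ⇒≼ᶜ c d c⊆d = (λ χ → proj₁) , (λ χ h → h , c⊆d χ h)

codeDistributive : Distributive
codeDistributive c d e c∩d≼e =
  c ⊔ e , d ⊔ e , ⊆ᶜ⇒≼ᶜ c (c ⊔ e) (⊆-⊔ˡ c e) , ⊆ᶜ⇒≼ᶜ d (d ⊔ e) (⊆-⊔ˡ d e) ,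
  (λ χ h → ⊆-⊔ʳ c e χ h , ⊆-⊔ʳ d e χ h) , ⊔-∩-⊆ c d e (≼ᶜ⇒⊆ᶜ (c ∩ d) e c∩d≼e)

truthSet : Formula → Filter
truthSet φ = record
  { _∋_  = φ ∈ᶜ_
  ; up   = λ {c} {d} h c≼d → ≼ᶜ⇒⊆ᶜ c d c≼d φ h
  ; top  = ⊥-⊴ φ
  ; meet = _,_
  }

_represents_ : Filter → Formula → Set
a represents φ = ∀ c → (a ∋ c) ⇔ (φ ∈ᶜ c)

represents-unique : ∀ a {φ φ'} → a represents φ → a represents φ' → PCL φ φ'
represents-unique a {φ} rφ rφ' = to (rφ' (↑ φ)) (from (rφ (↑ φ)) (⊴-refl φ))

⇒-preimage-represents : ∀ a {φ φ'} → a represents φ → a represents φ' →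
                        ∀ c → ⇒-preimage φ c ⊆ᶜ ⇒-preimage φ' c
⇒-preimage-represents a rφ rφ' c χ h =
  ∈ᶜ-upward c h (⇒-congˡ (represents-unique a rφ rφ') (represents-unique a rφ' rφ))

-- s(x, a) is the up-set of ⇒-preimage φ x when a is the truth set of φ, and
-- {⊤} otherwise; the disjunction avoids deciding whether a is definable.
Selected : Code → Filter → Code → Set
Selected x a z = (∀ χ → χ ∈ᶜ z) ⊎ Σ[ φ ∈ Formula ] (a represents φ × ⇒-preimage φ x ⊆ᶜ z)

selected-up : ∀ x a {z z'} → Selected x a z → z ≼ᶜ z' → Selected x a z'
selected-up x a {z} {z'} (inj₁ full) z≼z' = inj₁ (λ χ → ≼ᶜ⇒⊆ᶜ z z' z≼z' χ (full χ))
selected-up x a {z} {z'} (inj₂ (φ , rφ , f)) z≼z' =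
  inj₂ (φ , rφ , λ χ h → ≼ᶜ⇒⊆ᶜ z z' z≼z' χ (f χ h))

selected-∩ : ∀ x a {z z'} → Selected x a z → Selected x a z' → Selected x a (z ∩ z')
selected-∩ x a (inj₁ full) (inj₁ full') = inj₁ (λ χ → full χ , full' χ)
selected-∩ x a (inj₁ full) (inj₂ (φ , rφ , f')) = inj₂ (φ , rφ , λ χ h → full χ , f' χ h)
selected-∩ x a (inj₂ (φ , rφ , f)) (inj₁ full') = inj₂ (φ , rφ , λ χ h → f χ h , full' χ)
selected-∩ x a (inj₂ (φ , rφ , f)) (inj₂ (φ' , rφ' , f')) =
  inj₂ (φ , rφ , λ χ h → f χ h , f' χ (⇒-preimage-represents a rφ rφ' x χ h))

selection : Code → Filter → Filter
selection x a = record
  { _∋_  = Selected x a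
  ; up   = λ {z} {z'} → selected-up x a {z} {z'}
  ; top  = inj₁ ⊥-⊴
  ; meet = λ {z} {z'} → selected-∩ x a {z} {z'}
  }

selection-⊤ : ∀ a z → Selected (↑ ⊥f) a z ⇔ (z ≈ᶜ ↑ ⊥f)
selection-⊤ a z = mk⇔
  (λ { (inj₁ full) → (λ χ _ → ⊥-⊴ χ) , (λ χ _ → full χ)
     ; (inj₂ (φ , _ , f)) → (λ χ _ → ⊥-⊴ χ) , (λ χ _ → f χ (⊥-⊴ (φ ⇒f χ))) })
  (λ (_ , ⊤⊆z) → inj₁ (λ χ → ⊤⊆z χ (⊥-⊴ χ)))

selection-antitone : ∀ x y a → x ≼ᶜ y → ∀ z → Selected y a z → Selected x a z
selection-antitone x y a x≼y z (inj₁ full) = inj₁ full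
selection-antitone x y a x≼y z (inj₂ (φ , rφ , f)) =
  inj₂ (φ , rφ , λ χ h → f χ (≼ᶜ⇒⊆ᶜ x y x≼y (φ ⇒f χ) h))

selection-∩ : ∀ x y a z → Selected (x ∩ y) a z →
              Σ[ u ∈ Code ] Σ[ v ∈ Code ] (Selected x a u × Selected y a v × u ∩ v ≼ᶜ z)
selection-∩ x y a z (inj₁ full) =
  z , z , inj₁ full , inj₁ full , ⊆ᶜ⇒≼ᶜ (z ∩ z) z (λ χ → proj₁)
selection-∩ x y a z (inj₂ (φ , rφ , f)) =
  u , v , inj₂ (φ , rφ , ⊆-⊔ˡ (⇒-preimage φ x) z) , inj₂ (φ , rφ , ⊆-⊔ˡ (⇒-preimage φ y) z) ,
  ⊆ᶜ⇒≼ᶜ (u ∩ v) z (⊔-∩-⊆ (⇒-preimage φ x) (⇒-preimage φ y) z f)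
  where
  u v : Code
  u = ⇒-preimage φ x ⊔ z
  v = ⇒-preimage φ y ⊔ z

selection-ext : ∀ x a b → (∀ c → (a ∋ c) ⇔ (b ∋ c)) → ∀ z → Selected x a z → Selected x b z
selection-ext x a b a≡b z (inj₁ full) = inj₁ full
selection-ext x a b a≡b z (inj₂ (φ , rφ , f)) =
  inj₂ (φ , (λ c → mk⇔ (λ h → to (rφ c) (from (a≡b c) h)) (λ h → to (a≡b c) (from (rφ c) h))) , f)

canonicalFrame : SelectionLFrame
canonicalFrame = record
  { L      = codeSemilattice
  ; s      = selection
  ; s-top  = selection-⊤
  ; s-anti = λ {x} {y} → selection-antitone x y
  ; s-meet = selection-∩
  ; s-ext  = selection-ext
  }

module _ where
  open Semantics canonicalFrame

  canonicalValuation : Valuation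
  canonicalValuation n = truthSet (var n)

  truth-lemma : ∀ φ → ⟦ φ ⟧ canonicalValuation represents φ
  truth-lemma (var n) c = mk⇔ (λ h → h) (λ h → h)
  truth-lemma ⊤f c = mk⇔ (λ _ → ⊤f∈ᶜ c) (λ _ → tt)
  truth-lemma ⊥f c = mk⇔ (λ (_ , ⊤⊆c) → ⊤⊆c ⊥f (⊴-refl ⊥f))
                         (λ ⊥∈c → (λ χ _ → ⊥-⊴ χ) , (λ χ → ∈ᶜ-upward c ⊥∈c))
  truth-lemma (φ ∧f ψ) c = mk⇔
    (λ (h , k) → ∈ᶜ-∧ c (to (truth-lemma φ c) h) (to (truth-lemma ψ c) k))
    (λ h → from (truth-lemma φ c) (∈ᶜ-upward c h ∧-elimˡ) ,
           from (truth-lemma ψ c) (∈ᶜ-upward c h ∧-elimʳ))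
  truth-lemma (φ ∨f ψ) c = mk⇔
    (λ (y , z , h , k , y∩z≼c) → ≼ᶜ⇒⊆ᶜ (y ∩ z) c y∩z≼c (φ ∨f ψ)
        (∈ᶜ-upward y (to (truth-lemma φ y) h) ∨-introˡ ,
         ∈ᶜ-upward z (to (truth-lemma ψ z) k) ∨-introʳ))
    (λ h → ↑ φ , ↑ ψ , from (truth-lemma φ (↑ φ)) (⊴-refl φ) ,
                       from (truth-lemma ψ (↑ ψ)) (⊴-refl ψ) ,
           ⊆ᶜ⇒≼ᶜ (↑ φ ∩ ↑ ψ) c (λ χ (φ⊴χ , ψ⊴χ) → ∈ᶜ-upward c h (∨-elim φ⊴χ ψ⊴χ)))
  truth-lemma (φ ⇒f ψ) c = mk⇔
    (λ h → to (truth-lemma ψ (⇒-preimage φ c))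
              (h (⇒-preimage φ c) (inj₂ (φ , truth-lemma φ , λ χ k → k))))
    (λ { h z (inj₁ full) → from (truth-lemma ψ z) (full ψ)
       ; h z (inj₂ (φ' , rφ' , f)) → from (truth-lemma ψ z)
           (f ψ (⇒-preimage-represents (⟦ φ ⟧ canonicalValuation) (truth-lemma φ) rφ' c ψ h)) })

PCL-complete : ∀ {φ ψ} → (∀ F → DistributiveFrame F → Validates F φ ψ) → PCL φ ψ
PCL-complete {φ} {ψ} valid =
  to (truth-lemma ψ (↑ φ))
     (valid canonicalFrame codeDistributive canonicalValuation (↑ φ)
            (from (truth-lemma φ (↑ φ)) (⊴-refl φ)))

theorem5p9 : ∀ φ ψ →
    PCL φ ψ ⇔ (∀ (F : SelectionLFrame) → DistributiveFrame F → Validates F φ ψ)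
theorem5p9 φ ψ = mk⇔ PCL-sound PCL-complete
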